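{- Let $X$ be a propositional variable and $E$ a closed $\lambda\mu$-term with $\vdash E:\perp\to X$. Then for each finite sequence $x\,\bar y$ of distinct $\lambda$-variables, $(E\;x\,\bar y)\triangleright^*\underline{\mu}.x$, where $\underline{\mu}.x$ denotes a term consisting of the variable $x$ preceded by $\mu$-abstractions and $\mu$-applications (i.e. a term in the smallest set containing $x$ and closed under $s\mapsto\mu\alpha.s$ and $s\mapsto(\alpha\,s)$ for $\mu$-variables $\alpha$).
   Context: $\lambda\mu$-terms over disjoint infinite sets of $\lambda$-variables and $\mu$-variables: $t ::= x \mid \lambda x.t \mid (t\,t) \mid \mu\alpha.t \mid (\alpha\,t)$. $u[\alpha:=^*v]$ replaces inductively each subterm $(\alpha\,w)$ of $u$ by $(\alpha\,(w\,v))$. Reduction $\triangleright$: compatible closure of $(\lambda x.u\;v)\triangleright u[x:=v]$ and $(\mu\alpha.u\;v)\triangleright\mu\alpha.u[\alpha:=^*v]$; $\triangleright^*$ its reflexive transitive closure. For $\bar y=y_1\dots y_n$, $(t\,x\,\bar y)=(\dots((t\,x)\,y_1)\dots y_n)$. Types: $A ::= X\mid\perp\mid A\to A$. Typing rules for $\Gamma\vdash t:A;\Delta$: (ax) $\Gamma\vdash x:A;\Delta$ if $x:A\in\Gamma$; ($\to_i$) from $\Gamma,x:A\vdash t:B;\Delta$ infer $\Gamma\vdash\lambda x.t:A\to B;\Delta$; ($\to_e$) from $\Gamma\vdash u:A\to B;\Delta$ and $\Gamma\vdash v:A;\Delta$ infer $\Gamma\vdash(u\,v):B;\Delta$; ($\mu$)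 from $\Gamma\vdash t:\perp;\Delta,\alpha:A$ infer $\Gamma\vdash\mu\alpha.t:A;\Delta$; ($\perp$) from $\Gamma\vdash t:A;\Delta,\alpha:A$ infer $\Gamma\vdash(\alpha\,t):\perp;\Delta,\alpha:A$. $\vdash E:A$ means empty contexts. -}

module Defs where

open import Data.Nat using (ℕ; zero; suc; _≡ᵇ_)
open import Data.Bool using (if_then_else_)
open import Data.List using (List; []; _∷_)
open import Relation.Binary.Construct.Closure.ReflexiveTransitive using (Star)

-- λμ-terms, locally nameless-free de Bruijn style with TWO disjoint
-- sorts of indices: λ-variables and μ-variables.
-- `lam t` binds λ-index 0 in t; `mu t` binds μ-index 0 in t.
-- Free λ-variable with index x is `var x` (free indices are the names).
data Term : Set where
  var   : ℕ → Term
  lam   : Term → Term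
  app   : Term → Term → Term
  mu    : Term → Term
  named : ℕ → Term → Term     -- (α t)

ext : (ℕ → ℕ) → ℕ → ℕ
ext ρ zero    = zero
ext ρ (suc n) = suc (ρ n)

renλ : (ℕ → ℕ) → Term → Term
renλ ρ (var x)     = var (ρ x)
renλ ρ (lam t)     = lam (renλ (ext ρ) t)
renλ ρ (app t u)   = app (renλ ρ t) (renλ ρ u)
renλ ρ (mu t)      = mu (renλ ρ t)
renλ ρ (named a t) = named a (renλ ρ t)

renμ : (ℕ → ℕ) → Term → Term
renμ ρ (var x)     = var x
renμ ρ (lam t)     = lam (renμ ρ t)
renμ ρ (app t u)   = app (renμ ρ t) (renμ ρ u)
renμ ρ (mu t)      = mu (renμ (ext ρ) t)
renμ ρ (named a t) = named (ρ a) (renμ ρ t)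

exts : (ℕ → Term) → ℕ → Term
exts σ zero    = var zero
exts σ (suc n) = renλ suc (σ n)

substλ : (ℕ → Term) → Term → Term
substλ σ (var x)     = σ x
substλ σ (lam t)     = lam (substλ (exts σ) t)
substλ σ (app t u)   = app (substλ σ t) (substλ σ u)
substλ σ (mu t)      = mu (substλ (λ n → renμ suc (σ n)) t)
substλ σ (named a t) = named a (substλ σ t)

-- u[x0 := v], where x0 is λ-index 0 (other indices decremented)
single : Term → ℕ → Term
single v zero    = v
single v (suc n) = var n

_[0:=_] : Term → Term → Term
u [0:= v ] = substλ (single v) u

-- u[α :=* v] : replace each subterm (α w) by (α (w v))
msubst : ℕ → Term → Term → Term
msubst α v (var x)     = var x
msubst α v (lam t)     = lam (msubst α (renλ suc v) t)
msubst α v (app t u)   = app (msubst α v t) (msubst α v u)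
msubst α v (mu t)      = mu (msubst (suc α) (renμ suc v) t)
msubst α v (named β w) =
  if β ≡ᵇ α then named β (app (msubst α v w) v) else named β (msubst α v w)

infix 4 _▷_
data _▷_ : Term → Term → Set where
  βλ     : ∀ {u v} → app (lam u) v ▷ u [0:= v ]
  βμ     : ∀ {u v} → app (mu u) v ▷ mu (msubst zero (renμ suc v) u)
  ξlam   : ∀ {t t'} → t ▷ t' → lam t ▷ lam t'
  ξappl  : ∀ {t t' u} → t ▷ t' → app t u ▷ app t' u
  ξappr  : ∀ {t u u'} → u ▷ u' → app t u ▷ app t u'
  ξmu    : ∀ {t t'} → t ▷ t' → mu t ▷ mu t'
  ξnamed : ∀ {a t t'} → t ▷ t' → named a t ▷ named a t'

infix 4 _▷*_
_▷*_ : Term → Term → Set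
_▷*_ = Star _▷_

infixr 7 _⇒_
data Type : Set where
  atom : ℕ → Type
  bot  : Type
  _⇒_  : Type → Type → Type

data _∋_∶_ : List Type → ℕ → Type → Set where
  here  : ∀ {Γ A} → (A ∷ Γ) ∋ zero ∶ A
  there : ∀ {Γ A B n} → Γ ∋ n ∶ A → (B ∷ Γ) ∋ suc n ∶ A

data _⊢_∶_⨾_ : List Type → Term → Type → List Type → Set where
  ax   : ∀ {Γ Δ x A} → Γ ∋ x ∶ A → Γ ⊢ var x ∶ A ⨾ Δ
  →i   : ∀ {Γ Δ t A B} → (A ∷ Γ) ⊢ t ∶ B ⨾ Δ → Γ ⊢ lam t ∶ A ⇒ B ⨾ Δ
  →e   : ∀ {Γ Δ u v A B} → Γ ⊢ u ∶ A ⇒ B ⨾ Δ → Γ ⊢ v ∶ A ⨾ Δ → Γ ⊢ app u v ∶ B ⨾ Δ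
  μi   : ∀ {Γ Δ t A} → Γ ⊢ t ∶ bot ⨾ (A ∷ Δ) → Γ ⊢ mu t ∶ A ⨾ Δ
  ⊥i   : ∀ {Γ Δ t α A} → Δ ∋ α ∶ A → Γ ⊢ t ∶ A ⨾ Δ → Γ ⊢ named α t ∶ bot ⨾ Δ

apps : Term → List ℕ → Term
apps t []       = t
apps t (y ∷ ys) = apps (app t (var y)) ys

data MuPrefixed (x : ℕ) : Term → Set where
  base  : MuPrefixed x (var x)
  pmu   : ∀ {s} → MuPrefixed x s → MuPrefixed x (mu s)
  pnamed : ∀ {s} α → MuPrefixed x s → MuPrefixed x (named α s)

-- Proof by realizability.  Fix x and call a term good when it reduces to
-- some μ̲.x.  A type A denotes a set ⟦ A ⟧ of realizers together with a
-- set of stacks (argument lists) against which realizers yield good terms: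
-- stacks of an atom are lists of λ-variables, ⊥ has only the empty stack,
-- and a stack of A ⇒ B is a realizer of A pushed on a stack of B.  Realizers
-- of A ⇒ B must keep working after injective renamings of μ-variables,
-- which is what lets the argument go under μ-binders.
--
-- Then every
-- typing rule is sound for semantic typing (adequacy), and the theorem
-- applies the realizer of ⊥ → X to x and to ȳ.

module Submission where

open import Defs
open import Data.Nat using (ℕ; zero; suc; _≡ᵇ_)
open import Data.Nat.Properties using (_≟_; suc-injective)
open import Data.Bool using (true; false; if_then_else_)
open import Data.List using (List; []; _∷_; [_]; map; foldl; _++_; _∷ʳ_)
open import Data.List.Properties
  using (map-∘; map-cong; map-id; map-++; ++-identityʳ; ∷ʳ-++; foldl-∷ʳ)
open import Data.List.Relation.Unary.Unique.Propositional using (Unique)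
open import Data.Product using (Σ; _×_; _,_)
open import Data.Empty using (⊥)
open import Function using (_∘_; id)
open import Function.Definitions using (Injective)
open import Relation.Nullary using (yes; no)
open import Relation.Nullary.Decidable using (dec-true; dec-false)
open import Relation.Binary.PropositionalEquality
  using (_≡_; _≢_; _≗_; refl; sym; trans; cong; cong₂; subst)
open import Relation.Binary.Construct.Closure.ReflexiveTransitive
  using (ε; _◅_; _◅◅_; gmap)

map-square : ∀ {A B C D : Set} {f : B → D} {g : A → B} {h : C → D} {k : A → C} →
             (∀ w → f (g w) ≡ h (k w)) →
             ∀ l → map f (map g l) ≡ map h (map k l)
map-square eq l = trans (sym (map-∘ l)) (trans (map-cong eq l) (map-∘ l))

ext-cong : ∀ {ρ ρ'} → ρ ≗ ρ' → ext ρ ≗ ext ρ'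
ext-cong ρ≗ρ' zero    = refl
ext-cong ρ≗ρ' (suc n) = cong suc (ρ≗ρ' n)

ext-∘ : ∀ ρ ρ' → ext (ρ ∘ ρ') ≗ ext ρ ∘ ext ρ'
ext-∘ ρ ρ' zero    = refl
ext-∘ ρ ρ' (suc n) = refl

ext-id : ext id ≗ id
ext-id zero    = refl
ext-id (suc n) = refl

renλ-cong : ∀ {ρ ρ'} → ρ ≗ ρ' → ∀ t → renλ ρ t ≡ renλ ρ' t
renλ-cong h (var x)     = cong var (h x)
renλ-cong h (lam t)     = cong lam (renλ-cong (ext-cong h) t)
renλ-cong h (app t u)   = cong₂ app (renλ-cong h t) (renλ-cong h u)
renλ-cong h (mu t)      = cong mu (renλ-cong h t)
renλ-cong h (named a t) = cong (named a) (renλ-cong h t)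

renμ-cong : ∀ {ρ ρ'} → ρ ≗ ρ' → ∀ t → renμ ρ t ≡ renμ ρ' t
renμ-cong h (var x)     = refl
renμ-cong h (lam t)     = cong lam (renμ-cong h t)
renμ-cong h (app t u)   = cong₂ app (renμ-cong h t) (renμ-cong h u)
renμ-cong h (mu t)      = cong mu (renμ-cong (ext-cong h) t)
renμ-cong h (named a t) = cong₂ named (h a) (renμ-cong h t)

renλ-∘ : ∀ ρ ρ' t → renλ ρ (renλ ρ' t) ≡ renλ (ρ ∘ ρ') t
renλ-∘ ρ ρ' (var x)     = refl
renλ-∘ ρ ρ' (lam t)     =
  cong lam (trans (renλ-∘ (ext ρ) (ext ρ') t) (sym (renλ-cong (ext-∘ ρ ρ') t)))
renλ-∘ ρ ρ' (app t u)   = cong₂ app (renλ-∘ ρ ρ' t) (renλ-∘ ρ ρ' u)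
renλ-∘ ρ ρ' (mu t)      = cong mu (renλ-∘ ρ ρ' t)
renλ-∘ ρ ρ' (named a t) = cong (named a) (renλ-∘ ρ ρ' t)

renμ-∘ : ∀ ρ ρ' t → renμ ρ (renμ ρ' t) ≡ renμ (ρ ∘ ρ') t
renμ-∘ ρ ρ' (var x)     = refl
renμ-∘ ρ ρ' (lam t)     = cong lam (renμ-∘ ρ ρ' t)
renμ-∘ ρ ρ' (app t u)   = cong₂ app (renμ-∘ ρ ρ' t) (renμ-∘ ρ ρ' u)
renμ-∘ ρ ρ' (mu t)      =
  cong mu (trans (renμ-∘ (ext ρ) (ext ρ') t) (sym (renμ-cong (ext-∘ ρ ρ') t)))
renμ-∘ ρ ρ' (named a t) = cong (named (ρ (ρ' a))) (renμ-∘ ρ ρ' t)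

renμ-id : ∀ t → renμ id t ≡ t
renμ-id (var x)     = refl
renμ-id (lam t)     = cong lam (renμ-id t)
renμ-id (app t u)   = cong₂ app (renμ-id t) (renμ-id u)
renμ-id (mu t)      = cong mu (trans (renμ-cong ext-id t) (renμ-id t))
renμ-id (named a t) = cong (named a) (renμ-id t)

renλ-renμ : ∀ ρ ρ' t → renλ ρ (renμ ρ' t) ≡ renμ ρ' (renλ ρ t)
renλ-renμ ρ ρ' (var x)     = refl
renλ-renμ ρ ρ' (lam t)     = cong lam (renλ-renμ (ext ρ) ρ' t)
renλ-renμ ρ ρ' (app t u)   = cong₂ app (renλ-renμ ρ ρ' t) (renλ-renμ ρ ρ' u)
renλ-renμ ρ ρ' (mu t)      = cong mu (renλ-renμ ρ (ext ρ') t)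
renλ-renμ ρ ρ' (named a t) = cong (named (ρ' a)) (renλ-renμ ρ ρ' t)

renλ-weaken : ∀ ρ w → renλ (ext ρ) (renλ suc w) ≡ renλ suc (renλ ρ w)
renλ-weaken ρ w = trans (renλ-∘ (ext ρ) suc w) (sym (renλ-∘ suc ρ w))

renμ-weaken : ∀ ρ w → renμ (ext ρ) (renμ suc w) ≡ renμ suc (renμ ρ w)
renμ-weaken ρ w = trans (renμ-∘ (ext ρ) suc w) (sym (renμ-∘ suc ρ w))

exts-cong : ∀ {σ σ'} → σ ≗ σ' → exts σ ≗ exts σ'
exts-cong h zero    = refl
exts-cong h (suc n) = cong (renλ suc) (h n)

substλ-cong : ∀ {σ σ'} → σ ≗ σ' → ∀ t → substλ σ t ≡ substλ σ' t
substλ-cong h (var x)     = h x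
substλ-cong h (lam t)     = cong lam (substλ-cong (exts-cong h) t)
substλ-cong h (app t u)   = cong₂ app (substλ-cong h t) (substλ-cong h u)
substλ-cong h (mu t)      = cong mu (substλ-cong (cong (renμ suc) ∘ h) t)
substλ-cong h (named a t) = cong (named a) (substλ-cong h t)

substλ-renλ : ∀ σ ρ t → substλ σ (renλ ρ t) ≡ substλ (σ ∘ ρ) t
substλ-renλ σ ρ (var x)     = refl
substλ-renλ σ ρ (lam t)     =
  cong lam (trans (substλ-renλ (exts σ) (ext ρ) t) (substλ-cong exts-ext t))
  where
  exts-ext : exts σ ∘ ext ρ ≗ exts (σ ∘ ρ)
  exts-ext zero    = refl
  exts-ext (suc n) = refl
substλ-renλ σ ρ (app t u)   = cong₂ app (substλ-renλ σ ρ t) (substλ-renλ σ ρ u)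
substλ-renλ σ ρ (mu t)      = cong mu (substλ-renλ (renμ suc ∘ σ) ρ t)
substλ-renλ σ ρ (named a t) = cong (named a) (substλ-renλ σ ρ t)

renλ-substλ : ∀ ρ σ t → renλ ρ (substλ σ t) ≡ substλ (renλ ρ ∘ σ) t
renλ-substλ ρ σ (var x)     = refl
renλ-substλ ρ σ (lam t)     =
  cong lam (trans (renλ-substλ (ext ρ) (exts σ) t) (substλ-cong ext-exts t))
  where
  ext-exts : renλ (ext ρ) ∘ exts σ ≗ exts (renλ ρ ∘ σ)
  ext-exts zero    = refl
  ext-exts (suc n) = renλ-weaken ρ (σ n)
renλ-substλ ρ σ (app t u)   = cong₂ app (renλ-substλ ρ σ t) (renλ-substλ ρ σ u)
renλ-substλ ρ σ (mu t)      =
  cong mu (trans (renλ-substλ ρ (renμ suc ∘ σ) t)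
                 (substλ-cong (λ n → renλ-renμ ρ suc (σ n)) t))
renλ-substλ ρ σ (named a t) = cong (named a) (renλ-substλ ρ σ t)

substλ-id : ∀ t → substλ var t ≡ t
substλ-id (var x)     = refl
substλ-id (lam t)     = cong lam (trans (substλ-cong exts-var t) (substλ-id t))
  where
  exts-var : exts var ≗ var
  exts-var zero    = refl
  exts-var (suc n) = refl
substλ-id (app t u)   = cong₂ app (substλ-id t) (substλ-id u)
substλ-id (mu t)      = cong mu (substλ-id t)
substλ-id (named a t) = cong (named a) (substλ-id t)

renμ-substλ : ∀ ρ σ t → renμ ρ (substλ σ t) ≡ substλ (renμ ρ ∘ σ) (renμ ρ t)
renμ-substλ ρ σ (var x)     = refl
renμ-substλ ρ σ (lam t)     =
  cong lam (trans (renμ-substλ ρ (exts σ) t) (substλ-cong renμ-exts (renμ ρ t)))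
  where
  renμ-exts : renμ ρ ∘ exts σ ≗ exts (renμ ρ ∘ σ)
  renμ-exts zero    = refl
  renμ-exts (suc n) = sym (renλ-renμ suc ρ (σ n))
renμ-substλ ρ σ (app t u)   = cong₂ app (renμ-substλ ρ σ t) (renμ-substλ ρ σ u)
renμ-substλ ρ σ (mu t)      =
  cong mu (trans (renμ-substλ (ext ρ) (renμ suc ∘ σ) t)
                 (substλ-cong (λ n → renμ-weaken ρ (σ n)) (renμ (ext ρ) t)))
renμ-substλ ρ σ (named a t) = cong (named (ρ a)) (renμ-substλ ρ σ t)

substλ-single-weaken : ∀ u w → substλ (single u) (renλ suc w) ≡ w
substλ-single-weaken u w = trans (substλ-renλ (single u) suc w) (substλ-id w)

renμ-[0:=] : ∀ ρ u v → renμ ρ (u [0:= v ]) ≡ (renμ ρ u) [0:= renμ ρ v ]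
renμ-[0:=] ρ u v = trans (renμ-substλ ρ (single v) u) (substλ-cong renμ-single (renμ ρ u))
  where
  renμ-single : renμ ρ ∘ single v ≗ single (renμ ρ v)
  renμ-single zero    = refl
  renμ-single (suc n) = refl

Inj : (ℕ → ℕ) → Set
Inj = Injective _≡_ _≡_

ext-injective : ∀ {ρ} → Inj ρ → Inj (ext ρ)
ext-injective inj {zero}  {zero}  eq = refl
ext-injective inj {suc a} {suc b} eq = cong suc (inj (suc-injective eq))

≡ᵇ-injective : ∀ {ρ} → Inj ρ → ∀ a b → (ρ a ≡ᵇ ρ b) ≡ (a ≡ᵇ b)
≡ᵇ-injective {ρ} inj a b with a ≟ b
... | yes refl = trans (dec-true (ρ a ≟ ρ a) refl) (sym (dec-true (a ≟ a) refl))
... | no a≢b   = trans (dec-false (ρ a ≟ ρ b) (a≢b ∘ inj)) (sym (dec-false (a ≟ b) a≢b))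

msubst-renλ : ∀ ρ α w s → renλ ρ (msubst α w s) ≡ msubst α (renλ ρ w) (renλ ρ s)
msubst-renλ ρ α w (var x)     = refl
msubst-renλ ρ α w (lam s)     =
  cong lam (trans (msubst-renλ (ext ρ) α (renλ suc w) s)
                  (cong (λ z → msubst α z (renλ (ext ρ) s)) (renλ-weaken ρ w)))
msubst-renλ ρ α w (app s u)   = cong₂ app (msubst-renλ ρ α w s) (msubst-renλ ρ α w u)
msubst-renλ ρ α w (mu s)      =
  cong mu (trans (msubst-renλ ρ (suc α) (renμ suc w) s)
                 (cong (λ z → msubst (suc α) z (renλ ρ s)) (renλ-renμ ρ suc w)))
msubst-renλ ρ α w (named β s) with β ≡ᵇ α
... | true  = cong (λ z → named β (app z (renλ ρ w))) (msubst-renλ ρ α w s)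
... | false = cong (named β) (msubst-renλ ρ α w s)

-- u[α :=* v] is stable under injective μ-renamings (a non-injective one
-- could identify α with another name).
msubst-renμ : ∀ {ρ} → Inj ρ → ∀ α w s →
              renμ ρ (msubst α w s) ≡ msubst (ρ α) (renμ ρ w) (renμ ρ s)
msubst-renμ inj α w (var x)     = refl
msubst-renμ {ρ} inj α w (lam s) =
  cong lam (trans (msubst-renμ inj α (renλ suc w) s)
                  (cong (λ z → msubst (ρ α) z (renμ ρ s)) (sym (renλ-renμ suc ρ w))))
msubst-renμ inj α w (app s u)   = cong₂ app (msubst-renμ inj α w s) (msubst-renμ inj α w u)
msubst-renμ {ρ} inj α w (mu s)  =
  cong mu (trans (msubst-renμ (ext-injective inj) (suc α) (renμ suc w) s)
                 (cong (λ z → msubst (suc (ρ α)) z (renμ (ext ρ) s)) (renμ-weaken ρ w)))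
msubst-renμ {ρ} inj α w (named β s) rewrite ≡ᵇ-injective inj β α with β ≡ᵇ α
... | true  = cong (λ z → named (ρ β) (app z (renμ ρ w))) (msubst-renμ inj α w s)
... | false = cong (named (ρ β)) (msubst-renμ inj α w s)

msubst-fresh : ∀ {ρ α} → (∀ n → ρ n ≢ α) → ∀ w s → msubst α w (renμ ρ s) ≡ renμ ρ s
msubst-fresh h w (var x)     = refl
msubst-fresh h w (lam s)     = cong lam (msubst-fresh h (renλ suc w) s)
msubst-fresh h w (app s u)   = cong₂ app (msubst-fresh h w s) (msubst-fresh h w u)
msubst-fresh {ρ} {α} h w (mu s) = cong mu (msubst-fresh ext-avoids (renμ suc w) s)
  where
  ext-avoids : ∀ n → ext ρ n ≢ suc α
  ext-avoids zero    ()
  ext-avoids (suc n) eq = h n (suc-injective eq)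
msubst-fresh {ρ} {α} h w (named b s) rewrite dec-false (ρ b ≟ α) (h b) =
  cong (named (ρ b)) (msubst-fresh h w s)

infixl 5 _·_
_·_ : Term → List Term → Term
t · π = foldl app t π

·-hom : (f : Term → Term) → (∀ a b → f (app a b) ≡ app (f a) (f b)) →
        ∀ t π → f (t · π) ≡ f t · map f π
·-hom f hom t []      = refl
·-hom f hom t (u ∷ π) = trans (·-hom f hom (app t u) π) (cong (_· map f π) (hom t u))

apps≡· : ∀ t ys → apps t ys ≡ t · map var ys
apps≡· t []       = refl
apps≡· t (y ∷ ys) = apps≡· (app t (var y)) ys

renμ-vars : ∀ ρ ys → map (renμ ρ) (map var ys) ≡ map var ys
renμ-vars ρ []       = refl
renμ-vars ρ (y ∷ ys) = cong (var y ∷_) (renμ-vars ρ ys)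

renμ-·vars : ∀ ρ t ys → renμ ρ (t · map var ys) ≡ renμ ρ t · map var ys
renμ-·vars ρ t ys =
  trans (·-hom (renμ ρ) (λ _ _ → refl) t (map var ys)) (cong (renμ ρ t ·_) (renμ-vars ρ ys))

-- Instantiation: λ-variables become terms, and each μ-variable α is
-- renamed to ρ α while the stack τ α is appended to every (α w).

_•_ : Term → (ℕ → Term) → ℕ → Term
(u • σ) zero    = u
(u • σ) (suc n) = σ n

wkμ : (ℕ → Term) → ℕ → Term
wkμ σ n = renμ suc (σ n)

liftλ : (ℕ → List Term) → ℕ → List Term
liftλ τ n = map (renλ suc) (τ n)

pushμ : List Term → (ℕ → List Term) → ℕ → List Term
pushμ π τ zero    = map (renμ suc) π
pushμ π τ (suc n) = map (renμ suc) (τ n)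

inst : (ℕ → Term) → (ℕ → List Term) → (ℕ → ℕ) → Term → Term
inst σ τ ρ (var x)     = σ x
inst σ τ ρ (lam t)     = lam (inst (exts σ) (liftλ τ) ρ t)
inst σ τ ρ (app t u)   = app (inst σ τ ρ t) (inst σ τ ρ u)
inst σ τ ρ (mu t)      = mu (inst (wkμ σ) (pushμ [] τ) (ext ρ) t)
inst σ τ ρ (named a t) = named (ρ a) (inst σ τ ρ t · τ a)

inst-cong : ∀ {σ σ' τ τ' ρ ρ'} → σ ≗ σ' → τ ≗ τ' → ρ ≗ ρ' →
            ∀ t → inst σ τ ρ t ≡ inst σ' τ' ρ' t
inst-cong hσ hτ hρ (var x)     = hσ x
inst-cong hσ hτ hρ (lam t)     =
  cong lam (inst-cong (exts-cong hσ) (cong (map (renλ suc)) ∘ hτ) hρ t)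
inst-cong hσ hτ hρ (app t u)   = cong₂ app (inst-cong hσ hτ hρ t) (inst-cong hσ hτ hρ u)
inst-cong {τ = τ} {τ'} hσ hτ hρ (mu t) =
  cong mu (inst-cong (cong (renμ suc) ∘ hσ) pushμ-cong (ext-cong hρ) t)
  where
  pushμ-cong : pushμ [] τ ≗ pushμ [] τ'
  pushμ-cong zero    = refl
  pushμ-cong (suc n) = cong (map (renμ suc)) (hτ n)
inst-cong hσ hτ hρ (named a t) =
  cong₂ named (hρ a) (cong₂ _·_ (inst-cong hσ hτ hρ t) (hτ a))

inst-id : ∀ t → inst var (λ _ → []) id t ≡ t
inst-id (var x)     = refl
inst-id (lam t)     = cong lam (trans (inst-cong exts-var (λ _ → refl) (λ _ → refl) t) (inst-id t))
  where
  exts-var : exts var ≗ var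
  exts-var zero    = refl
  exts-var (suc n) = refl
inst-id (app t u)   = cong₂ app (inst-id t) (inst-id u)
inst-id (mu t)      = cong mu (trans (inst-cong (λ _ → refl) no-stacks ext-id t) (inst-id t))
  where
  no-stacks : pushμ [] (λ _ → []) ≗ (λ _ → [])
  no-stacks zero    = refl
  no-stacks (suc n) = refl
inst-id (named a t) = cong (named a) (inst-id t)

substλ-inst : ∀ θ σ τ ρ t →
              substλ θ (inst σ τ ρ t) ≡ inst (substλ θ ∘ σ) (map (substλ θ) ∘ τ) ρ t
substλ-inst θ σ τ ρ (var x)     = refl
substλ-inst θ σ τ ρ (lam t)     =
  cong lam (trans (substλ-inst (exts θ) (exts σ) (liftλ τ) ρ t)
                  (inst-cong exts-exts (map-square substλ-weaken ∘ τ) (λ _ → refl) t))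
  where
  substλ-weaken : ∀ w → substλ (exts θ) (renλ suc w) ≡ renλ suc (substλ θ w)
  substλ-weaken w = trans (substλ-renλ (exts θ) suc w) (sym (renλ-substλ suc θ w))
  exts-exts : substλ (exts θ) ∘ exts σ ≗ exts (substλ θ ∘ σ)
  exts-exts zero    = refl
  exts-exts (suc n) = substλ-weaken (σ n)
substλ-inst θ σ τ ρ (app t u)   = cong₂ app (substλ-inst θ σ τ ρ t) (substλ-inst θ σ τ ρ u)
substλ-inst θ σ τ ρ (mu t)      =
  cong mu (trans (substλ-inst (wkμ θ) (wkμ σ) (pushμ [] τ) (ext ρ) t)
                 (inst-cong (substλ-wkμ ∘ σ) pushμ-substλ (λ _ → refl) t))
  where
  substλ-wkμ : ∀ w → substλ (wkμ θ) (renμ suc w) ≡ renμ suc (substλ θ w)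
  substλ-wkμ w = sym (renμ-substλ suc θ w)
  pushμ-substλ : map (substλ (wkμ θ)) ∘ pushμ [] τ ≗ pushμ [] (map (substλ θ) ∘ τ)
  pushμ-substλ zero    = refl
  pushμ-substλ (suc n) = map-square substλ-wkμ (τ n)
substλ-inst θ σ τ ρ (named a t) =
  cong (named (ρ a)) (trans (·-hom (substλ θ) (λ _ _ → refl) _ (τ a))
                            (cong (_· map (substλ θ) (τ a)) (substλ-inst θ σ τ ρ t)))

renμ-inst : ∀ ρ' σ τ ρ t →
            renμ ρ' (inst σ τ ρ t) ≡ inst (renμ ρ' ∘ σ) (map (renμ ρ') ∘ τ) (ρ' ∘ ρ) t
renμ-inst ρ' σ τ ρ (var x)     = refl
renμ-inst ρ' σ τ ρ (lam t)     =
  cong lam (trans (renμ-inst ρ' (exts σ) (liftλ τ) ρ t)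
                  (inst-cong renμ-exts (map-square renμ-weakenλ ∘ τ) (λ _ → refl) t))
  where
  renμ-weakenλ : ∀ w → renμ ρ' (renλ suc w) ≡ renλ suc (renμ ρ' w)
  renμ-weakenλ w = sym (renλ-renμ suc ρ' w)
  renμ-exts : renμ ρ' ∘ exts σ ≗ exts (renμ ρ' ∘ σ)
  renμ-exts zero    = refl
  renμ-exts (suc n) = renμ-weakenλ (σ n)
renμ-inst ρ' σ τ ρ (app t u)   = cong₂ app (renμ-inst ρ' σ τ ρ t) (renμ-inst ρ' σ τ ρ u)
renμ-inst ρ' σ τ ρ (mu t)      =
  cong mu (trans (renμ-inst (ext ρ') (wkμ σ) (pushμ [] τ) (ext ρ) t)
                 (inst-cong (renμ-weaken ρ' ∘ σ) pushμ-renμ (sym ∘ ext-∘ ρ' ρ) t))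
  where
  pushμ-renμ : map (renμ (ext ρ')) ∘ pushμ [] τ ≗ pushμ [] (map (renμ ρ') ∘ τ)
  pushμ-renμ zero    = refl
  pushμ-renμ (suc n) = map-square (renμ-weaken ρ') (τ n)
renμ-inst ρ' σ τ ρ (named a t) =
  cong (named (ρ' (ρ a))) (trans (·-hom (renμ ρ') (λ _ _ → refl) _ (τ a))
                                 (cong (_· map (renμ ρ') (τ a)) (renμ-inst ρ' σ τ ρ t)))

-- The stacks after u[α :=* w]: w is appended to the stack of every
-- μ-variable that the instantiation renames to α.
appendAt : (ℕ → ℕ) → ℕ → Term → (ℕ → List Term) → ℕ → List Term
appendAt ρ α w τ n = if ρ n ≡ᵇ α then τ n ∷ʳ w else τ n

map-appendAt : ∀ f ρ α w τ n →
               appendAt ρ α (f w) (map f ∘ τ) n ≡ map f (appendAt ρ α w τ n)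
map-appendAt f ρ α w τ n with ρ n ≡ᵇ α
... | true  = sym (map-++ f (τ n) [ w ])
... | false = refl

msubst-· : ∀ α w {s s' π π'} → msubst α w s ≡ s' → map (msubst α w) π ≡ π' →
           msubst α w (s · π) ≡ s' · π'
msubst-· α w {s} {π = π} hs hπ = trans (·-hom (msubst α w) (λ _ _ → refl) s π) (cong₂ _·_ hs hπ)

msubst-named : ∀ α w β {s s' π π'} → msubst α w s ≡ s' → map (msubst α w) π ≡ π' →
               msubst α w (named β (s · π)) ≡ named β (s' · (if β ≡ᵇ α then π' ∷ʳ w else π'))
msubst-named α w β {s' = s'} {π' = π'} hs hπ with β ≡ᵇ α
... | true  = cong (named β) (trans (cong (λ z → app z w) (msubst-· α w hs hπ))
                                    (sym (foldl-∷ʳ app s' w π')))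
... | false = cong (named β) (msubst-· α w hs hπ)

msubst-inst : ∀ α w σ τ ρ → (∀ n → msubst α w (σ n) ≡ σ n) →
              (∀ n → map (msubst α w) (τ n) ≡ τ n) →
              ∀ t → msubst α w (inst σ τ ρ t) ≡ inst σ (appendAt ρ α w τ) ρ t
msubst-inst α w σ τ ρ hσ hτ (var x)     = hσ x
msubst-inst α w σ τ ρ hσ hτ (lam t)     =
  cong lam (trans (msubst-inst α (renλ suc w) (exts σ) (liftλ τ) ρ hσ' hτ' t)
                  (inst-cong (λ _ → refl) (map-appendAt (renλ suc) ρ α w τ) (λ _ → refl) t))
  where
  weaken-msubst : ∀ s → msubst α (renλ suc w) (renλ suc s) ≡ renλ suc (msubst α w s)
  weaken-msubst s = sym (msubst-renλ suc α w s)
  hσ' : ∀ n → msubst α (renλ suc w) (exts σ n) ≡ exts σ n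
  hσ' zero    = refl
  hσ' (suc n) = trans (weaken-msubst (σ n)) (cong (renλ suc) (hσ n))
  hτ' : ∀ n → map (msubst α (renλ suc w)) (liftλ τ n) ≡ liftλ τ n
  hτ' n = trans (map-square weaken-msubst (τ n)) (cong (map (renλ suc)) (hτ n))
msubst-inst α w σ τ ρ hσ hτ (app t u)   =
  cong₂ app (msubst-inst α w σ τ ρ hσ hτ t) (msubst-inst α w σ τ ρ hσ hτ u)
msubst-inst α w σ τ ρ hσ hτ (mu t)      =
  cong mu (trans (msubst-inst (suc α) (renμ suc w) (wkμ σ) (pushμ [] τ) (ext ρ) hσ' hτ' t)
                 (inst-cong (λ _ → refl) appended (λ _ → refl) t))
  where
  weaken-msubst : ∀ s → msubst (suc α) (renμ suc w) (renμ suc s) ≡ renμ suc (msubst α w s)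
  weaken-msubst s = sym (msubst-renμ suc-injective α w s)
  hσ' : ∀ n → msubst (suc α) (renμ suc w) (wkμ σ n) ≡ wkμ σ n
  hσ' n = trans (weaken-msubst (σ n)) (cong (renμ suc) (hσ n))
  hτ' : ∀ n → map (msubst (suc α) (renμ suc w)) (pushμ [] τ n) ≡ pushμ [] τ n
  hτ' zero    = refl
  hτ' (suc n) = trans (map-square weaken-msubst (τ n)) (cong (map (renμ suc)) (hτ n))
  appended : appendAt (ext ρ) (suc α) (renμ suc w) (pushμ [] τ) ≗ pushμ [] (appendAt ρ α w τ)
  appended zero    = refl
  appended (suc n) = map-appendAt (renμ suc) ρ α w τ n
msubst-inst α w σ τ ρ hσ hτ (named a t) =
  msubst-named α w (ρ a) (msubst-inst α w σ τ ρ hσ hτ t) (hτ a)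

inst-β : ∀ u σ τ ρ t → (inst (exts σ) (liftλ τ) ρ t) [0:= u ] ≡ inst (u • σ) τ ρ t
inst-β u σ τ ρ t =
  trans (substλ-inst (single u) (exts σ) (liftλ τ) ρ t)
        (inst-cong single-exts unlift (λ _ → refl) t)
  where
  single-exts : substλ (single u) ∘ exts σ ≗ u • σ
  single-exts zero    = refl
  single-exts (suc n) = substλ-single-weaken u (σ n)
  unlift : map (substλ (single u)) ∘ liftλ τ ≗ τ
  unlift n = trans (sym (map-∘ (τ n)))
                   (trans (map-cong (substλ-single-weaken u) (τ n)) (map-id (τ n)))

-- injectivity is needed for the μ-rule, via msubst-renμ
▷-renμ : ∀ {ρ} → Inj ρ → ∀ {t t'} → t ▷ t' → renμ ρ t ▷ renμ ρ t'
▷-renμ {ρ} inj (βλ {u} {v}) =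
  subst (app (lam (renμ ρ u)) (renμ ρ v) ▷_) (sym (renμ-[0:=] ρ u v)) βλ
▷-renμ {ρ} inj (βμ {u} {v}) = subst (λ z → app (mu (renμ (ext ρ) u)) (renμ ρ v) ▷ mu z) (sym eq) βμ
  where
  eq : renμ (ext ρ) (msubst zero (renμ suc v) u)
       ≡ msubst zero (renμ suc (renμ ρ v)) (renμ (ext ρ) u)
  eq = trans (msubst-renμ (ext-injective inj) zero (renμ suc v) u)
             (cong (λ z → msubst zero z (renμ (ext ρ) u)) (renμ-weaken ρ v))
▷-renμ inj (ξlam r)   = ξlam (▷-renμ inj r)
▷-renμ inj (ξappl r)  = ξappl (▷-renμ inj r)
▷-renμ inj (ξappr r)  = ξappr (▷-renμ inj r)
▷-renμ inj (ξmu r)    = ξmu (▷-renμ (ext-injective inj) r)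
▷-renμ inj (ξnamed r) = ξnamed (▷-renμ inj r)

·-▷ : ∀ π {t t'} → t ▷ t' → t · π ▷ t' · π
·-▷ []      r = r
·-▷ (u ∷ π) r = ·-▷ π (ξappl r)

MuPrefixed-renμ : ∀ {x ρ s} → MuPrefixed x s → MuPrefixed x (renμ ρ s)
MuPrefixed-renμ base           = base
MuPrefixed-renμ (pmu m)        = pmu (MuPrefixed-renμ m)
MuPrefixed-renμ {ρ = ρ} (pnamed α m) = pnamed (ρ α) (MuPrefixed-renμ m)

-- A μ-abstraction applied to a stack absorbs the stack into the stack of
-- its bound variable: (μα.t) π ▷* μα.t[α :=* π].
module μ-Absorption (σ : ℕ → Term) (τ : ℕ → List Term) (ρ : ℕ → ℕ) (t : Term) where

  μ-body : List Term → Term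
  μ-body acc = mu (inst (wkμ σ) (pushμ acc τ) (ext ρ) t)

  weakened-fresh : ∀ w l → map (msubst zero w) (map (renμ suc) l) ≡ map (renμ suc) l
  weakened-fresh w l = trans (sym (map-∘ l)) (map-cong (msubst-fresh (λ _ ()) w) l)

  absorb-one : ∀ acc v → app (μ-body acc) v ▷ μ-body (acc ∷ʳ v)
  absorb-one acc v = subst (λ z → app (μ-body acc) v ▷ mu z) eq βμ
    where
    fresh-stacks : ∀ n → map (msubst zero (renμ suc v)) (pushμ acc τ n) ≡ pushμ acc τ n
    fresh-stacks zero    = weakened-fresh (renμ suc v) acc
    fresh-stacks (suc n) = weakened-fresh (renμ suc v) (τ n)
    appended : appendAt (ext ρ) zero (renμ suc v) (pushμ acc τ) ≗ pushμ (acc ∷ʳ v) τ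
    appended zero    = sym (map-++ (renμ suc) acc [ v ])
    appended (suc n) = refl
    eq : msubst zero (renμ suc v) (inst (wkμ σ) (pushμ acc τ) (ext ρ) t)
         ≡ inst (wkμ σ) (pushμ (acc ∷ʳ v) τ) (ext ρ) t
    eq = trans (msubst-inst zero (renμ suc v) (wkμ σ) (pushμ acc τ) (ext ρ)
                            (msubst-fresh (λ _ ()) (renμ suc v) ∘ σ) fresh-stacks t)
               (inst-cong (λ _ → refl) appended (λ _ → refl) t)

  absorb : ∀ acc π → μ-body acc · π ▷* μ-body (acc ++ π)
  absorb acc []      = subst (λ l → μ-body acc ▷* μ-body l) (sym (++-identityʳ acc)) ε
  absorb acc (v ∷ π) =
    ·-▷ π (absorb-one acc v)
    ◅ subst (λ l → μ-body (acc ∷ʳ v) · π ▷* μ-body l) (∷ʳ-++ acc v π) (absorb (acc ∷ʳ v) π)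

module Realizability (x : ℕ) where

  Good : Term → Set
  Good t = Σ Term (λ s → (t ▷* s) × MuPrefixed x s)

  Good-expand : ∀ {t t'} → t ▷* t' → Good t' → Good t
  Good-expand r (s , r' , m) = s , r ◅◅ r' , m

  Good-renμ : ∀ {ρ t} → Inj ρ → Good t → Good (renμ ρ t)
  Good-renμ {ρ} inj (s , r , m) = renμ ρ s , gmap (renμ ρ) (▷-renμ inj) r , MuPrefixed-renμ m

  Good-mu : ∀ {t} → Good t → Good (mu t)
  Good-mu (s , r , m) = mu s , gmap mu ξmu r , pmu m

  Good-named : ∀ α {t} → Good t → Good (named α t)
  Good-named α (s , r , m) = named α s , gmap (named α) ξnamed r , pnamed α m

  ⟦_⟧ : Type → Term → Set
  ⟦ atom _ ⟧ t = ∀ ys → Good (t · map var ys)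
  ⟦ bot ⟧    t = Good t
  ⟦ A ⇒ B ⟧  t = ∀ ρ → Inj ρ → ∀ u → ⟦ A ⟧ u → ⟦ B ⟧ (app (renμ ρ t) u)

  Stack : Type → List Term → Set
  Stack (atom _) π       = Σ (List ℕ) (λ ys → π ≡ map var ys)
  Stack bot      π       = π ≡ []
  Stack (A ⇒ B)  []      = ⊥
  Stack (A ⇒ B)  (u ∷ π) = ⟦ A ⟧ u × Stack B π

  ⟦⟧-renμ : ∀ A {ρ t} → Inj ρ → ⟦ A ⟧ t → ⟦ A ⟧ (renμ ρ t)
  ⟦⟧-renμ (atom _) {ρ} {t} inj h ys = subst Good (renμ-·vars ρ t ys) (Good-renμ inj (h ys))
  ⟦⟧-renμ bot              inj h    = Good-renμ inj h
  ⟦⟧-renμ (A ⇒ B) {ρ} {t}  inj h ρ' inj' u hu =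
    subst (λ z → ⟦ B ⟧ (app z u)) (sym (renμ-∘ ρ' ρ t)) (h (ρ' ∘ ρ) (inj ∘ inj') u hu)

  Stack-renμ : ∀ A {ρ π} → Inj ρ → Stack A π → Stack A (map (renμ ρ) π)
  Stack-renμ (atom _) {ρ} inj (ys , refl) = ys , renμ-vars ρ ys
  Stack-renμ bot          inj refl        = refl
  Stack-renμ (A ⇒ B) {π = u ∷ π} inj (hu , hπ) = ⟦⟧-renμ A inj hu , Stack-renμ B inj hπ

  ⟦⟧-expand : ∀ A {t t'} → t ▷* t' → ⟦ A ⟧ t' → ⟦ A ⟧ t
  ⟦⟧-expand (atom _) r h ys = Good-expand (gmap (_· map var ys) (·-▷ (map var ys)) r) (h ys)
  ⟦⟧-expand bot      r h    = Good-expand r h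
  ⟦⟧-expand (A ⇒ B)  r h ρ inj u hu =
    ⟦⟧-expand B (gmap (λ z → app (renμ ρ z) u) (ξappl ∘ ▷-renμ inj) r) (h ρ inj u hu)

  ⟦⟧-app : ∀ {A B t u} → ⟦ A ⇒ B ⟧ t → ⟦ A ⟧ u → ⟦ B ⟧ (app t u)
  ⟦⟧-app {B = B} {t} {u} h hu = subst (λ z → ⟦ B ⟧ (app z u)) (renμ-id t) (h id id u hu)

  ⟦⟧-elim : ∀ A {t π} → ⟦ A ⟧ t → Stack A π → Good (t · π)
  ⟦⟧-elim (atom _) h (ys , refl) = h ys
  ⟦⟧-elim bot      h refl        = h
  ⟦⟧-elim (A ⇒ B) {π = u ∷ π} h (hu , hπ) = ⟦⟧-elim B (⟦⟧-app {A} {B} h hu) hπ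

  ⟦⟧-intro : ∀ A {t} → (∀ ρ → Inj ρ → ∀ π → Stack A π → Good (renμ ρ t · π)) → ⟦ A ⟧ t
  ⟦⟧-intro (atom _) {t} h ys =
    subst (λ z → Good (z · map var ys)) (renμ-id t) (h id id (map var ys) (ys , refl))
  ⟦⟧-intro bot {t} h = subst Good (renμ-id t) (h id id [] refl)
  ⟦⟧-intro (A ⇒ B) {t} h ρ inj u hu = ⟦⟧-intro B after-ρ
    where
    after-ρ : ∀ ρ' → Inj ρ' → ∀ π → Stack B π → Good (renμ ρ' (app (renμ ρ t) u) · π)
    after-ρ ρ' inj' π hπ =
      subst (λ z → Good (app z (renμ ρ' u) · π)) (sym (renμ-∘ ρ' ρ t))
            (h (ρ' ∘ ρ) (inj ∘ inj') (renμ ρ' u ∷ π) (⟦⟧-renμ A inj' hu , hπ))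

  Env : List Type → (ℕ → Term) → Set
  Env Γ σ = ∀ {n B} → Γ ∋ n ∶ B → ⟦ B ⟧ (σ n)

  StackEnv : List Type → (ℕ → List Term) → Set
  StackEnv Δ τ = ∀ {n B} → Δ ∋ n ∶ B → Stack B (τ n)

  Env-renμ : ∀ {Γ σ ρ} → Inj ρ → Env Γ σ → Env Γ (renμ ρ ∘ σ)
  Env-renμ inj hσ p = ⟦⟧-renμ _ inj (hσ p)

  StackEnv-renμ : ∀ {Δ τ ρ} → Inj ρ → StackEnv Δ τ → StackEnv Δ (map (renμ ρ) ∘ τ)
  StackEnv-renμ inj hτ p = Stack-renμ _ inj (hτ p)

  Env-extend : ∀ {Γ σ A u} → ⟦ A ⟧ u → Env Γ σ → Env (A ∷ Γ) (u • σ)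
  Env-extend hu hσ here      = hu
  Env-extend hu hσ (there p) = hσ p

  StackEnv-push : ∀ {Δ τ A π} → Stack A π → StackEnv Δ τ → StackEnv (A ∷ Δ) (pushμ π τ)
  StackEnv-push {A = A} hπ hτ here      = Stack-renμ A suc-injective hπ
  StackEnv-push         hπ hτ (there p) = Stack-renμ _ suc-injective (hτ p)

  record _⊨_∶_⨾_ (Γ : List Type) (t : Term) (A : Type) (Δ : List Type) : Set where
    field
      realizes : ∀ σ τ ρ → Env Γ σ → StackEnv Δ τ → ⟦ A ⟧ (inst σ τ ρ t)
  open _⊨_∶_⨾_

  ⊨-var : ∀ {Γ Δ y A} → Γ ∋ y ∶ A → Γ ⊨ var y ∶ A ⨾ Δ
  ⊨-var p .realizes σ τ ρ hσ hτ = hσ p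

  ⊨-lam : ∀ {Γ Δ t A B} → (A ∷ Γ) ⊨ t ∶ B ⨾ Δ → Γ ⊨ lam t ∶ A ⇒ B ⨾ Δ
  ⊨-lam {t = t} {B = B} ⊨t .realizes σ τ ρ hσ hτ ρ' inj u hu =
    subst (λ z → ⟦ B ⟧ (app z u)) (sym (renμ-inst ρ' σ τ ρ (lam t)))
          (⟦⟧-expand B (βλ ◅ ε) (subst ⟦ B ⟧ (sym (inst-β u σ' τ' (ρ' ∘ ρ) t)) body))
    where
    σ' : ℕ → Term
    σ' = renμ ρ' ∘ σ
    τ' : ℕ → List Term
    τ' = map (renμ ρ') ∘ τ
    body : ⟦ B ⟧ (inst (u • σ') τ' (ρ' ∘ ρ) t)
    body = ⊨t .realizes (u • σ') τ' (ρ' ∘ ρ)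
                        (Env-extend hu (Env-renμ inj hσ)) (StackEnv-renμ inj hτ)

  ⊨-app : ∀ {Γ Δ t u A B} → Γ ⊨ t ∶ A ⇒ B ⨾ Δ → Γ ⊨ u ∶ A ⨾ Δ → Γ ⊨ app t u ∶ B ⨾ Δ
  ⊨-app {A = A} {B} ⊨t ⊨u .realizes σ τ ρ hσ hτ =
    ⟦⟧-app {A} {B} (⊨t .realizes σ τ ρ hσ hτ) (⊨u .realizes σ τ ρ hσ hτ)

  ⊨-mu : ∀ {Γ Δ t A} → Γ ⊨ t ∶ bot ⨾ (A ∷ Δ) → Γ ⊨ mu t ∶ A ⨾ Δ
  ⊨-mu {Γ} {Δ} {t} {A} ⊨t .realizes σ τ ρ hσ hτ = ⟦⟧-intro A λ ρ' inj π hπ →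
    subst (λ z → Good (z · π)) (sym (renμ-inst ρ' σ τ ρ (mu t)))
          (absorbed _ _ (ρ' ∘ ρ) (Env-renμ inj hσ) (StackEnv-renμ inj hτ) π hπ)
    where
    -- the stack is absorbed by the μ-binder, after which the body is good
    absorbed : ∀ σ τ ρ → Env Γ σ → StackEnv Δ τ →
               ∀ π → Stack A π → Good (inst σ τ ρ (mu t) · π)
    absorbed σ τ ρ hσ hτ π hπ =
      Good-expand (absorb [] π)
        (Good-mu (⊨t .realizes (wkμ σ) (pushμ π τ) (ext ρ)
                               (Env-renμ suc-injective hσ) (StackEnv-push hπ hτ)))
      where open μ-Absorption σ τ ρ t

  ⊨-named : ∀ {Γ Δ t α A} → Δ ∋ α ∶ A → Γ ⊨ t ∶ A ⨾ Δ → Γ ⊨ named α t ∶ bot ⨾ Δ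
  ⊨-named {A = A} p ⊨t .realizes σ τ ρ hσ hτ =
    Good-named _ (⟦⟧-elim A (⊨t .realizes σ τ ρ hσ hτ) (hτ p))

  adequacy : ∀ {Γ Δ t A} → Γ ⊢ t ∶ A ⨾ Δ → Γ ⊨ t ∶ A ⨾ Δ
  adequacy (ax p)   = ⊨-var p
  adequacy (→i d)   = ⊨-lam (adequacy d)
  adequacy (→e d e) = ⊨-app (adequacy d) (adequacy e)
  adequacy (μi d)   = ⊨-mu (adequacy d)
  adequacy (⊥i p d) = ⊨-named p (adequacy d)

  closed-realizer : ∀ {t A} → [] ⊢ t ∶ A ⨾ [] → ⟦ A ⟧ t
  closed-realizer {t} {A} d =
    subst ⟦ A ⟧ (inst-id t) (adequacy d .realizes var (λ _ → []) id (λ ()) (λ ()))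

-- E realizes ⊥ → X and x is good, so (E x) realizes the atom X, which is
-- the claim for the stack ȳ.

theorem2p20 : (X : ℕ) (E : Term) → [] ⊢ E ∶ bot ⇒ atom X ⨾ [] →
    (x : ℕ) (ys : List ℕ) → Unique (x ∷ ys) →
    Σ Term (λ s → (apps (app E (var x)) ys ▷* s) × MuPrefixed x s)
theorem2p20 X E ⊢E x ys _ = subst Good (sym (apps≡· (app E (var x)) ys)) (E-x-realizes ys)
  where
  open Realizability x
  x-good : Good (var x)
  x-good = var x , ε , base
  E-x-realizes : ⟦ atom X ⟧ (app E (var x))
  E-x-realizes = ⟦⟧-app {bot} {atom X} (closed-realizer ⊢E) x-good
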